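{- The category $\mathbf{OA}$ has arbitrary (set-indexed) products (and coproducts).
   Context: Work in intuitionistic logic without choice. A positivity predicate on a complete lattice $L$ is a unary predicate $\mathrm{Pos}$ such that: (i) $\mathrm{Pos}(x)$ and $x\le y$ imply $\mathrm{Pos}(y)$; (ii) $\mathrm{Pos}(\bigvee X)$ implies $\mathrm{Pos}(x)$ for some $x\in X$; (iii) if $\mathrm{Pos}(x)\Rightarrow x\le y$, then $x\le y$. An o-algebra is a frame $L$ with a positivity predicate such that for all $x,y$: if $\mathrm{Pos}(z\wedge x)\Rightarrow\mathrm{Pos}(z\wedge y)$ for every $z\in L$, then $x\le y$. Write $x\bowtie y$ (overlap) for $\mathrm{Pos}(x\wedge y)$. Functions $f:L\to M$, $g:M\to L$ are symmetric if $f(x)\bowtie y\iff x\bowtie g(y)$; $f$ is symmetrizable if it has a (unique) symmetric $f^\dagger$. $\mathbf{OA}$ is the category of o-algebras and symmetrizable functions; it is a dagger category. -}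

module Defs where

open import Level using (Level; _⊔_; suc)
open import Data.Product using (Σ; _×_; _,_; proj₁; proj₂)
open import Function using (_∘_)

record OA (a ℓ i : Level) : Set (suc (a ⊔ ℓ ⊔ i)) where
  infix 4 _≤_ _≈_
  infixr 7 _∧_
  field
    Carrier : Set a
    _≤_     : Carrier → Carrier → Set ℓ
    ≤-refl  : ∀ {x} → x ≤ x
    ≤-trans : ∀ {x y z} → x ≤ y → y ≤ z → x ≤ z
    ⋁        : {I : Set i} → (I → Carrier) → Carrier
    ⋁-upper  : ∀ {I : Set i} (f : I → Carrier) (j : I) → f j ≤ ⋁ f
    ⋁-least  : ∀ {I : Set i} (f : I → Carrier) (x : Carrier) → (∀ j → f j ≤ x) → ⋁ f ≤ x
    ⊤        : Carrier
    ≤-⊤      : ∀ x → x ≤ ⊤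
    _∧_      : Carrier → Carrier → Carrier
    ∧-lowerˡ : ∀ x y → x ∧ y ≤ x
    ∧-lowerʳ : ∀ x y → x ∧ y ≤ y
    ∧-greatest : ∀ {x y z} → z ≤ x → z ≤ y → z ≤ x ∧ y
    ∧-distrib-⋁ : ∀ x {I : Set i} (f : I → Carrier) → x ∧ ⋁ f ≤ ⋁ (λ j → x ∧ f j)
    Pos      : Carrier → Set ℓ
    Pos-mono : ∀ {x y} → Pos x → x ≤ y → Pos y
    Pos-⋁    : ∀ {I : Set i} (f : I → Carrier) → Pos (⋁ f) → Σ I (λ j → Pos (f j))
    Pos-pos  : ∀ {x y} → (Pos x → x ≤ y) → x ≤ y
    Pos-sep  : ∀ {x y} → (∀ z → Pos (z ∧ x) → Pos (z ∧ y)) → x ≤ y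

  _≈_ : Carrier → Carrier → Set ℓ
  x ≈ y = (x ≤ y) × (y ≤ x)

  _⋈_ : Carrier → Carrier → Set ℓ
  x ⋈ y = Pos (x ∧ y)

open OA public using (Carrier)

module _ {a ℓ i : Level} where

  Symmetric : (L M : OA a ℓ i) → (Carrier L → Carrier M) → (Carrier M → Carrier L) → Set (a ⊔ ℓ)
  Symmetric L M f g = ∀ x y → (OA._⋈_ M (f x) y → OA._⋈_ L x (g y)) × (OA._⋈_ L x (g y) → OA._⋈_ M (f x) y)

  record Hom (L M : OA a ℓ i) : Set (a ⊔ ℓ) where
    field
      fun : Carrier L → Carrier M
      dag : Carrier M → Carrier L
      sym : Symmetric L M fun dag
  open Hom public

  _≈ₕ_ : {L M : OA a ℓ i} → Hom L M → Hom L M → Set (a ⊔ ℓ)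
  _≈ₕ_ {M = M} h h' = ∀ x → OA._≈_ M (fun h x) (fun h' x)

  _∘ₕ_ : {L M N : OA a ℓ i} → Hom M N → Hom L M → Hom L N
  fun (g ∘ₕ f) = fun g ∘ fun f
  dag (g ∘ₕ f) = dag f ∘ dag g
  sym (g ∘ₕ f) x z =
      (λ p → proj₁ (sym f x (dag g z)) (proj₁ (sym g (fun f x) z) p))
    , (λ p → proj₂ (sym g (fun f x) z) (proj₂ (sym f x (dag g z)) p))

  IsProduct : {k : Level} {K : Set k} → (L : K → OA a ℓ i) → (P : OA a ℓ i) → ((k : K) → Hom P (L k)) → Set (suc (a ⊔ ℓ ⊔ i) ⊔ k)
  IsProduct {K = K} L P π =
    ∀ (X : OA a ℓ i) (f : (k : K) → Hom X (L k)) →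
      Σ (Hom X P) λ h →
        (∀ k → (π k ∘ₕ h) ≈ₕ f k) ×
        (∀ (h' : Hom X P) → (∀ k → (π k ∘ₕ h') ≈ₕ f k) → h' ≈ₕ h)

  IsCoproduct : {k : Level} {K : Set k} → (L : K → OA a ℓ i) → (C : OA a ℓ i) → ((k : K) → Hom (L k) C) → Set (suc (a ⊔ ℓ ⊔ i) ⊔ k)
  IsCoproduct {K = K} L C ι =
    ∀ (X : OA a ℓ i) (f : (k : K) → Hom (L k) X) →
      Σ (Hom C X) λ h →
        (∀ k → (h ∘ₕ ι k) ≈ₕ f k) ×
        (∀ (h' : Hom C X) → (∀ k → (h' ∘ₕ ι k) ≈ₕ f k) → h' ≈ₕ h)

module Submission where

-- The product of a family (L j) is the componentwise frame
-- Π j. L j, in which an element is positive when some component is.  Its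
-- projection π j has as symmetric partner the "point" δ j w, the family that
-- is w at j and bottom elsewhere (a join over proofs of j ≡ j'); the key fact
-- is  c ⋈ δ j w ⇔ c j ⋈ w, which also yields the o-algebra axiom.  The pairing
-- of maps f k : X → L k is x ↦ (f k x)ₖ with partner y ↦ ⋁ₖ (f k)† (y k).
--
-- OA is a dagger category whose dagger reverses composition and
-- respects equality of morphisms (symmetric partners are unique).  Hence any
-- product with projections π is, formally, a coproduct with injections π j †.

open import Defs
open import Level using (Level; _⊔_; Lift; lift)
open import Data.Product using (Σ; _×_; _,_; proj₁; proj₂; map₂)
open import Relation.Binary.PropositionalEquality using (_≡_; refl; subst)

module Overlap {a ℓ i : Level} (X : OA a ℓ i) where
  open OA X

  ⋈-sym : ∀ {x y} → x ⋈ y → y ⋈ x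
  ⋈-sym p = Pos-mono p (∧-greatest (∧-lowerʳ _ _) (∧-lowerˡ _ _))

  ⋈-monoˡ : ∀ {x x' y} → x ≤ x' → x ⋈ y → x' ⋈ y
  ⋈-monoˡ le p = Pos-mono p (∧-greatest (≤-trans (∧-lowerˡ _ _) le) (∧-lowerʳ _ _))

  ⋈-monoʳ : ∀ {x y y'} → y ≤ y' → x ⋈ y → x ⋈ y'
  ⋈-monoʳ le p = ⋈-sym (⋈-monoˡ le (⋈-sym p))

  ⋈-⋁-split : ∀ {x} {I : Set i} (f : I → Carrier X) → x ⋈ ⋁ f → Σ I (λ j → x ⋈ f j)
  ⋈-⋁-split {x} f p = Pos-⋁ _ (Pos-mono p (∧-distrib-⋁ x f))

  ⋈-⋁-intro : ∀ {x} {I : Set i} (f : I → Carrier X) → Σ I (λ j → x ⋈ f j) → x ⋈ ⋁ f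
  ⋈-⋁-intro f (j , p) = ⋈-monoʳ (⋁-upper f j) p

module _ {a ℓ i : Level} {L M : OA a ℓ i} (h : Hom L M) where

  ⋈-to-dag : ∀ {x y} → OA._⋈_ M (fun h x) y → OA._⋈_ L x (dag h y)
  ⋈-to-dag {x} {y} = proj₁ (sym h x y)

  ⋈-from-dag : ∀ {x y} → OA._⋈_ L x (dag h y) → OA._⋈_ M (fun h x) y
  ⋈-from-dag {x} {y} = proj₂ (sym h x y)

infix 30 _†
_† : {a ℓ i : Level} {L M : OA a ℓ i} → Hom L M → Hom M L
fun (h †) = dag h
dag (h †) = fun h
sym (_†  {L = L} {M} h) y x =
    (λ p → Overlap.⋈-sym M (⋈-from-dag h (Overlap.⋈-sym L p)))
  , (λ p → Overlap.⋈-sym L (⋈-to-dag h (Overlap.⋈-sym M p)))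

module _ {a ℓ i : Level} {L M : OA a ℓ i} where

  dag-≤ : (h h' : Hom L M) → (∀ x → OA._≤_ M (fun h x) (fun h' x)) →
          ∀ y → OA._≤_ L (dag h y) (dag h' y)
  dag-≤ h h' le y = OA.Pos-sep L λ z p →
    ⋈-to-dag h' (Overlap.⋈-monoˡ M (le z) (⋈-from-dag h p))

  †-cong : (h h' : Hom L M) → h ≈ₕ h' → (h †) ≈ₕ (h' †)
  †-cong h h' e y = dag-≤ h h' (λ x → proj₁ (e x)) y
                      , dag-≤ h' h (λ x → proj₂ (e x)) y

-- Dagger duality: a product whose projections are daggered is a coproduct.
-- This uses only that † reverses composition (definitionally, on underlying
-- maps), is involutive, and respects ≈ₕ.
product⇒coproduct : {a ℓ i k : Level} {K : Set k} {L : K → OA a ℓ i}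
  {P : OA a ℓ i} {π : (j : K) → Hom P (L j)} →
  IsProduct L P π → IsCoproduct L P (λ j → π j †)
product⇒coproduct {π = π} product X f =
  let (h , commutes , unique) = product X (λ j → f j †)
  in  h †
    , (λ j → †-cong (π j ∘ₕ h) (f j †) (commutes j))
    , (λ h' e → †-cong (h' †) h
                  (unique (h' †) (λ j → †-cong (h' ∘ₕ π j †) (f j) (e j))))

module Product {a ℓ i k : Level} (K : Set k) (L : K → OA (k ⊔ a) (k ⊔ ℓ) (k ⊔ i)) where
  open OA hiding (Carrier)
  module O (j : K) = Overlap (L j)

  -- δ j w : the family equal to w at j and bottom elsewhere.
  transport : {j j' : K} → j ≡ j' → Carrier (L j) → Carrier (L j')
  transport p = subst (λ j → Carrier (L j)) p

  δ : (j : K) → Carrier (L j) → (j' : K) → Carrier (L j')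
  δ j w j' = ⋁ (L j') (λ (p : Lift i (j ≡ j')) → transport (Lift.lower p) w)

  δ-at : (j : K) (w : Carrier (L j)) → _≤_ (L j) w (δ j w j)
  δ-at j w = ⋁-upper (L j) _ (lift refl)

  ⋈-δ : (c : (j : K) → Carrier (L j)) (j : K) (w : Carrier (L j)) →
        Σ K (λ j' → _⋈_ (L j') (c j') (δ j w j')) → _⋈_ (L j) (c j) w
  ⋈-δ c j w (j' , q) with O.⋈-⋁-split j' _ q
  ... | lift refl , r = r

  P : OA (k ⊔ a) (k ⊔ ℓ) (k ⊔ i)
  Carrier P = (j : K) → Carrier (L j)
  _≤_ P x y = ∀ j → _≤_ (L j) (x j) (y j)
  ≤-refl P j = ≤-refl (L j)
  ≤-trans P p q j = ≤-trans (L j) (p j) (q j)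
  ⋁ P f j = ⋁ (L j) (λ p → f p j)
  ⋁-upper P f p j = ⋁-upper (L j) (λ p → f p j) p
  ⋁-least P f x h j = ⋁-least (L j) (λ p → f p j) (x j) (λ p → h p j)
  ⊤ P j = ⊤ (L j)
  ≤-⊤ P x j = ≤-⊤ (L j) (x j)
  _∧_ P x y j = _∧_ (L j) (x j) (y j)
  ∧-lowerˡ P x y j = ∧-lowerˡ (L j) (x j) (y j)
  ∧-lowerʳ P x y j = ∧-lowerʳ (L j) (x j) (y j)
  ∧-greatest P p q j = ∧-greatest (L j) (p j) (q j)
  ∧-distrib-⋁ P x f j = ∧-distrib-⋁ (L j) (x j) (λ p → f p j)
  Pos P x = Σ K λ j → Pos (L j) (x j)
  Pos-mono P (j , p) le = j , Pos-mono (L j) p (le j)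
  Pos-⋁ P f (j , p) = let (q , r) = Pos-⋁ (L j) (λ q → f q j) p in q , (j , r)
  Pos-pos P h j = Pos-pos (L j) (λ p → h (j , p) j)
  -- Separation in component j is tested against the points δ j w.
  Pos-sep P {x} {y} h j = Pos-sep (L j) λ w p →
    let q = h (δ j w) (j , O.⋈-monoˡ j (δ-at j w) p)
    in  O.⋈-sym j (⋈-δ y j w (map₂ (O.⋈-sym _) q))

  π : (j : K) → Hom P (L j)
  fun (π j) x = x j
  dag (π j) w = δ j w
  sym (π j) x w = (λ q → j , O.⋈-monoʳ j (δ-at j w) q) , ⋈-δ x j w

  pairing : (X : OA (k ⊔ a) (k ⊔ ℓ) (k ⊔ i)) → ((j : K) → Hom X (L j)) → Hom X P
  fun (pairing X f) x j = fun (f j) x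
  dag (pairing X f) y = ⋁ X (λ (j : Lift i K) → dag (f (Lift.lower j)) (y (Lift.lower j)))
  sym (pairing X f) x y =
      (λ (j , q) → Overlap.⋈-⋁-intro X _ (lift j , ⋈-to-dag (f j) q))
    , (λ q → let (lift j , r) = Overlap.⋈-⋁-split X _ q in j , ⋈-from-dag (f j) r)

  -- Maps into P are determined componentwise, so the pairing is universal.
  product : IsProduct L P π
  product X f = pairing X f
              , (λ j x → ≤-refl (L j) , ≤-refl (L j))
              , (λ h e x → (λ j → proj₁ (e j x)) , (λ j → proj₂ (e j x)))

proposition4p8 : ∀ {a ℓ i k : Level} (K : Set k) (L : K → OA (k ⊔ a) (k ⊔ ℓ) (k ⊔ i)) →
    (Σ (OA (k ⊔ a) (k ⊔ ℓ) (k ⊔ i)) λ P → Σ ((j : K) → Hom P (L j)) λ π → IsProduct L P π)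
    × (Σ (OA (k ⊔ a) (k ⊔ ℓ) (k ⊔ i)) λ C → Σ ((j : K) → Hom (L j) C) λ ι → IsCoproduct L C ι)
proposition4p8 {a} {ℓ} {i} {k} K L =
    (P , π , product)
  , (P , (λ j → π j †) , product⇒coproduct {π = π} product)
  where open Product {a} {ℓ} {i} {k} K L
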